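{- For every $n\ge1$, $t_{n,0}(y,\boldsymbol{\phi})=y\,t_{n,1}(y,\boldsymbol{\phi})$.
   Context: Let $\boldsymbol{\phi}=(\phi_m)_{m\ge0}$ and $y$ be indeterminates and $\widehat{\phi}_m=m!\,\phi_m$. For a rooted tree $T$ on a totally ordered vertex set, $j$ is a descendant of $i$ if the path from the root to $j$ passes through $i$ (including $j=i$); an edge $ij$ with $j$ a child of $i$ is improper if some descendant of $j$ is lower-numbered than $i$, and proper otherwise; $j$ is then a proper child of $i$ if the edge $ij$ is proper. Let $\mathrm{imprope}(T)$ be the number of improper edges and $\mathrm{pdeg}_T(i)$ the number of proper children of $i$. Let $\mathcal{T}^{\langle 1;k\rangle}_{n+1}$ be the set of rooted trees on $[n+1]$ in which vertex $1$ has exactly $k$ children, and $t_{n,k}(y,\boldsymbol{\phi})=\sum_{T\in\mathcal{T}^{\langle 1;k\rangle}_{n+1}} y^{\mathrm{imprope}(T)}\prod_{i=2}^{n+1}\widehat{\phi}_{\mathrm{pdeg}_T(i)}$. -}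

module Defs where

open import Level using (Level)
open import Data.Bool using (Bool; true; false; _∧_; _∨_; not; if_then_else_)
open import Data.Nat using (ℕ; zero; suc; _≡ᵇ_; _<ᵇ_; _!)
open import Data.Fin using (Fin; zero; suc; toℕ; _≟_)
open import Data.Vec using (Vec; []; _∷_; lookup)
open import Data.List using (List; []; _∷_; map; concatMap; filterᵇ; length; foldr; allFin)
open import Data.Bool.ListAction using (any; all)
open import Relation.Nullary.Decidable using (⌊_⌋)
open import Algebra.Bundles using (CommutativeSemiring)

-- A rooted tree on the vertex set Fin N (vertex i ↔ label toℕ i + 1, so the
-- total order is preserved and vertex "1" is `zero`) is encoded by its parent
-- map p : Vec (Fin N) N, where the root is the unique fixed point of p.

ParentMap : ℕ → Set
ParentMap N = Vec (Fin N) N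

module _ {N : ℕ} (p : ParentMap N) where

  par : Fin N → Fin N
  par i = lookup p i

  iter : ℕ → Fin N → Fin N
  iter zero i = i
  iter (suc k) i = iter k (par i)

  _==_ : Fin N → Fin N → Bool
  i == j = ⌊ i ≟ j ⌋

  isRoot : Fin N → Bool
  isRoot i = par i == i

  countᵇ : (Fin N → Bool) → ℕ
  countᵇ P = length (filterᵇ P (allFin N))

  upTo : ℕ → List ℕ
  upTo zero = zero ∷ []
  upTo (suc m) = suc m ∷ upTo m

  -- p encodes a rooted tree: exactly one root, and every vertex reaches a
  -- root by following parents (N steps suffice)
  isTree : Bool
  isTree = (countᵇ isRoot ≡ᵇ 1) ∧ all (λ i → isRoot (iter N i)) (allFin N)

  -- j is a descendant of i: i lies on the path from the root to j
  -- (i.e. i is j or an ancestor of j); includes j = i.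
  isDesc : Fin N → Fin N → Bool
  isDesc i j = any (λ k → iter k j == i) (upTo N)

  isChild : Fin N → Fin N → Bool
  isChild i j = not (isRoot j) ∧ (par j == i)

  improperEdge : Fin N → Fin N → Bool
  improperEdge i j = any (λ d → isDesc j d ∧ (toℕ d <ᵇ toℕ i)) (allFin N)

  imprope : ℕ
  imprope = countᵇ (λ j → not (isRoot j) ∧ improperEdge (par j) j)

  pdeg : Fin N → ℕ
  pdeg i = countᵇ (λ j → isChild i j ∧ not (improperEdge i j))

  nChildren : Fin N → ℕ
  nChildren i = countᵇ (isChild i)

allVecs : (N m : ℕ) → List (Vec (Fin N) m)
allVecs N zero = [] ∷ []
allVecs N (suc m) = concatMap (λ v → map (_∷ v) (allFin N)) (allVecs N m)

-- 𝒯^{⟨1;k⟩}_{n+1}: rooted trees on [n+1] (= Fin (suc n)) in which vertex 1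
-- (= zero) has exactly k children
trees : (n k : ℕ) → List (ParentMap (suc n))
trees n k = filterᵇ (λ p → isTree p ∧ (nChildren p zero ≡ᵇ k)) (allVecs (suc n) (suc n))

-- t_{n,k}(y, φ), evaluated in an arbitrary commutative semiring R at
-- y ∈ R and φ : ℕ → R.  Since ℕ[y, φ₀, φ₁, …] is the free commutative
-- semiring, an identity holding for all such evaluations is exactly the
-- polynomial identity.
module _ {c ℓ : Level} (R : CommutativeSemiring c ℓ) where
  open CommutativeSemiring R
  open import Algebra.Definitions.RawSemiring rawSemiring using (_×_; _^_)

  φhat : (ℕ → Carrier) → ℕ → Carrier
  φhat φ m = (m !) × φ m

  weight : {n : ℕ} → Carrier → (ℕ → Carrier) → ParentMap (suc n) → Carrier
  weight {n} y φ p =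
    (y ^ imprope p) * foldr (λ i acc → φhat φ (pdeg p (suc i)) * acc) 1# (allFin n)

  t : (n k : ℕ) → Carrier → (ℕ → Carrier) → Carrier
  t n k y φ = foldr (λ p acc → weight y φ p + acc) 0# (trees n k)

module Submission where

-- If vertex 1 has exactly one child c, letting c take the place of 1 and hanging 1 below c as a
-- leaf gives a tree in which 1 has no children; conversely a childless vertex 1 (not the root,
-- as n ≥ 1) changes places with its parent.  These inverse maps biject the trees counted by
-- t_{n,1} with those counted by t_{n,0}.  The edge between 1 and c was proper (no vertex is
-- smaller than 1) and becomes improper (1 lies below c), while every other edge keeps the set of
-- vertices below it, hence its status; so imprope grows by one, the proper degrees of the
-- vertices 2, …, n+1 are unchanged, and the weight is multiplied by exactly y.

open import Defs
open import Level using (Level)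
open import Data.Nat using (ℕ; _≤_)
open import Algebra.Bundles using (CommutativeSemiring)

open import Data.Bool using (Bool; true; false; T; not; _∧_; if_then_else_)
open import Data.Bool.ListAction using (all; or)
open import Data.Bool.Properties using (T-∧; T-≡; T-not-≡; ¬-not)
open import Data.Empty using (⊥-elim)
open import Data.Fin using (Fin; zero; suc; toℕ; _≟_)
import Data.Fin.Properties as Finₚ
open import Data.List as List
  using (List; []; _∷_; length; filterᵇ; tabulate; allFin; concatMap; cartesianProductWith; _++_)
open import Data.List.Properties using (map-cong; foldr-cong; foldr-map)
open import Data.List.Membership.Propositional using (_∈_; lose)
open import Data.List.Membership.Propositional.Properties
  using (∈-map⁺; ∈-map⁻; ∈-allFin; ∈-cartesianProductWith⁺; ∈-filter⁺; ∈-filter⁻)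
open import Data.List.Membership.Propositional.Properties.WithK using (unique∧set⇒bag)
open import Data.List.Relation.Binary.BagAndSetEquality using (∼bag⇒↭)
open import Data.List.Relation.Binary.Permutation.Propositional using (_↭_; ↭⇒↭ₛ′)
import Data.List.Relation.Binary.Permutation.Propositional.Properties as ↭ₚ
open import Data.List.Relation.Binary.Permutation.Setoid.Properties using (foldr-commMonoid)
import Data.List.Relation.Unary.All as All
open import Data.List.Relation.Unary.All.Properties as Allₚ using (all⁺; all⁻)
open import Data.List.Relation.Unary.AllPairs using ([]; _∷_)
open import Data.List.Relation.Unary.Any using (here; there; satisfied)
open import Data.List.Relation.Unary.Any.Properties using (any⁺; any⁻)
open import Data.List.Relation.Unary.Unique.Propositional using (Unique)
open import Data.List.Relation.Unary.Unique.Propositional.Properties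
  using (cartesianProductWith⁺; allFin⁺; filter⁺)
open import Data.Nat using (zero; suc; _<_; z≤n; _≡ᵇ_; _<ᵇ_)
open import Data.Nat.Induction using (<-rec)
open import Data.Nat.Properties
  using ( suc-injective; ≡ᵇ⇒≡; ≡⇒≡ᵇ; *-suc; m+[n∸m]≡n; ≤-trans; <⇒≤; ≰⇒>; _≤?_
        ; n<1+n; m<1+n⇒m≤n; m≤n⇒m<n∨m≡n; +-monoˡ-<)
open import Data.Product using (∃; ∃-syntax; _×_; _,_; proj₁; proj₂)
open import Data.Sum using (_⊎_; inj₁; inj₂)
open import Data.Vec using (Vec; []; _∷_; lookup; _[_]≔_)
open import Data.Vec.Properties
  using (lookup∘update; lookup∘update′; tabulate∘lookup; tabulate-cong
        ; ∷-injectiveˡ; ∷-injectiveʳ)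
open import Function using (id; _∘_; _⇔_; Equivalence; mk⇔)
open import Function.Properties.Equivalence using () renaming (trans to ⇔-trans; sym to ⇔-sym)
open import Relation.Binary.PropositionalEquality
  using (_≡_; _≢_; refl; sym; trans; cong; cong₂; subst; module ≡-Reasoning)
open import Relation.Nullary using (¬_; Dec; yes; no)
open import Relation.Nullary.Decidable
  using (T?; toWitness; fromWitness; toWitnessFalse; fromWitnessFalse)

private
  variable
    n : ℕ

T-injective : ∀ {a b} → T a ⇔ T b → a ≡ b
T-injective {true}  {true}  _   = refl
T-injective {true}  {false} a⇔b = ⊥-elim (Equivalence.to a⇔b _)
T-injective {false} {true}  a⇔b = ⊥-elim (Equivalence.from a⇔b _)
T-injective {false} {false} _   = refl

¬T⇒≡false : ∀ {b} → ¬ T b → b ≡ false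
¬T⇒≡false ¬b = ¬-not (¬b ∘ Equivalence.from T-≡)

T-not⇒¬T : ∀ {b} → T (not b) → ¬ T b
T-not⇒¬T t = subst T (Equivalence.to T-not-≡ t)

both-true : ∀ {a b} → T a → T b → a ≡ b
both-true ta tb = trans (Equivalence.to T-≡ ta) (sym (Equivalence.to T-≡ tb))

both-false : ∀ {a b} → ¬ T a → ¬ T b → a ≡ b
both-false ¬ta ¬tb = trans (¬T⇒≡false ¬ta) (sym (¬T⇒≡false ¬tb))

count : (Fin n → Bool) → ℕ
count {zero}  P = 0
count {suc n} P = if P zero then suc (count (P ∘ suc)) else count (P ∘ suc)

countᵇ≡count : ∀ {A : Set} (P : A → Bool) (f : Fin n → A) →
               length (filterᵇ P (tabulate f)) ≡ count (P ∘ f)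
countᵇ≡count {zero}  P f = refl
countᵇ≡count {suc n} P f with P (f zero)
... | true  = cong suc (countᵇ≡count P (f ∘ suc))
... | false = countᵇ≡count P (f ∘ suc)

count-cong : {P Q : Fin n → Bool} → (∀ i → P i ≡ Q i) → count P ≡ count Q
count-cong {zero}          P≗Q = refl
count-cong {suc n} {P} {Q} P≗Q rewrite P≗Q zero with Q zero
... | true  = cong suc (count-cong (P≗Q ∘ suc))
... | false = count-cong (P≗Q ∘ suc)

count-const-false : count {n} (λ _ → false) ≡ 0
count-const-false {zero}  = refl
count-const-false {suc n} = count-const-false {n}

count≡0 : ∀ {n} {P : Fin n → Bool} → (∀ i → ¬ T (P i)) → count P ≡ 0
count≡0 {n} ¬P = trans (count-cong (¬T⇒≡false ∘ ¬P)) (count-const-false {n})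

count≡0⇒¬T : {P : Fin n → Bool} → count P ≡ 0 → ∀ i → ¬ T (P i)
count≡0⇒¬T {suc n} {P} #P≡0 i with P zero in eq
count≡0⇒¬T {suc n} {P} #P≡0 zero    | false = subst T eq
count≡0⇒¬T {suc n} {P} #P≡0 (suc i) | false = count≡0⇒¬T #P≡0 i

count-update : {P Q : Fin n → Bool} (a : Fin n) → (∀ i → i ≢ a → P i ≡ Q i) →
               ¬ T (P a) → T (Q a) → count Q ≡ suc (count P)
count-update {suc n} {P} {Q} zero P≗Q ¬Pa Qa
  rewrite ¬T⇒≡false ¬Pa | Equivalence.to T-≡ Qa =
  cong suc (count-cong (λ i → sym (P≗Q (suc i) λ ())))
count-update {suc n} {P} {Q} (suc a) P≗Q ¬Pa Qa rewrite P≗Q zero (λ ()) with Q zero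
... | true  = cong suc (count-update a P≗Q∘suc ¬Pa Qa)
  where P≗Q∘suc = λ i i≢a → P≗Q (suc i) (i≢a ∘ Finₚ.suc-injective)
... | false = count-update a P≗Q∘suc ¬Pa Qa
  where P≗Q∘suc = λ i i≢a → P≗Q (suc i) (i≢a ∘ Finₚ.suc-injective)

count≡1 : ∀ {n} {P : Fin n → Bool} c → T (P c) → (∀ i → i ≢ c → ¬ T (P i)) → count P ≡ 1
count≡1 {n} c Pc ¬P = trans (count-update c (λ i i≢c → sym (¬T⇒≡false (¬P i i≢c))) (λ ()) Pc)
                            (cong suc (count-const-false {n}))

count≡1⇒∃! : {P : Fin n → Bool} → count P ≡ 1 → ∃[ c ] T (P c) × (∀ i → T (P i) → i ≡ c)
count≡1⇒∃! {suc n} {P} #P≡1 with P zero in eq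
... | true  = zero , subst T (sym eq) _ , only-zero
  where
  only-zero : ∀ i → T (P i) → i ≡ zero
  only-zero zero    _ = refl
  only-zero (suc i) t = ⊥-elim (count≡0⇒¬T (suc-injective #P≡1) i t)
... | false with count≡1⇒∃! #P≡1
...   | c , Pc , unique = suc c , Pc , only-suc-c
  where
  only-suc-c : ∀ i → T (P i) → i ≡ suc c
  only-suc-c zero    t = ⊥-elim (subst T eq t)
  only-suc-c (suc i) t = cong suc (unique i t)

module _ {N : ℕ} (p : ParentMap N) where

  open import Data.Nat using (_+_; _*_; _∸_)

  Reaches : Fin N → Fin N → Set
  Reaches d a = ∃[ k ] iter p k d ≡ a

  RootedAt : Fin N → Set
  RootedAt ρ = par p ρ ≡ ρ × (∀ j → Reaches j ρ)

  Child : Fin N → Fin N → Set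
  Child i j = par p j ≡ i × j ≢ i

  iter-+ : ∀ k m i → iter p (k + m) i ≡ iter p m (iter p k i)
  iter-+ zero    m i = refl
  iter-+ (suc k) m i = iter-+ k m (par p i)

  iter-suc : ∀ k i → iter p (suc k) i ≡ par p (iter p k i)
  iter-suc zero    i = refl
  iter-suc (suc k) i = iter-suc k (par p i)

  iter-fixed : ∀ {ρ} → par p ρ ≡ ρ → ∀ k → iter p k ρ ≡ ρ
  iter-fixed ρ-fixed zero    = refl
  iter-fixed ρ-fixed (suc k) = trans (cong (iter p k) ρ-fixed) (iter-fixed ρ-fixed k)

  iter-periodic : ∀ {s v} → iter p s v ≡ v → ∀ r → iter p (r * s) v ≡ v
  iter-periodic         cycle zero    = refl
  iter-periodic {s} {v} cycle (suc r) =
    trans (iter-+ s (r * s) v) (trans (cong (iter p (r * s)) cycle) (iter-periodic cycle r))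

  cycle⇒root : ∀ {ρ} → RootedAt ρ → ∀ m v → iter p (suc m) v ≡ v → v ≡ ρ
  cycle⇒root {ρ} (ρ-fixed , reach) m v cycle with reach v
  ... | r , v↝ρ = begin
    v                            ≡⟨ iter-periodic cycle r ⟨
    iter p (r * suc m) v         ≡⟨ cong (λ k → iter p k v) (*-suc r m) ⟩
    iter p (r + r * m) v         ≡⟨ iter-+ r (r * m) v ⟩
    iter p (r * m) (iter p r v)  ≡⟨ cong (iter p (r * m)) v↝ρ ⟩
    iter p (r * m) ρ             ≡⟨ iter-fixed ρ-fixed (r * m) ⟩
    ρ                            ∎
    where open ≡-Reasoning

  fixed⇒root : ∀ {ρ j} → RootedAt ρ → par p j ≡ j → j ≡ ρ
  fixed⇒root rooted = cycle⇒root rooted 0 _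

  iter-shortcut : ∀ {a b k d} → iter p a d ≡ iter p b d → b ≤ k →
                  iter p (a + (k ∸ b)) d ≡ iter p k d
  iter-shortcut {a} {b} {k} {d} same b≤k = begin
    iter p (a + (k ∸ b)) d       ≡⟨ iter-+ a (k ∸ b) d ⟩
    iter p (k ∸ b) (iter p a d)  ≡⟨ cong (iter p (k ∸ b)) same ⟩
    iter p (k ∸ b) (iter p b d)  ≡⟨ iter-+ b (k ∸ b) d ⟨
    iter p (b + (k ∸ b)) d       ≡⟨ cong (λ k → iter p k d) (m+[n∸m]≡n b≤k) ⟩
    iter p k d                   ∎
    where open ≡-Reasoning

  -- among the first N + 1 vertices of a longer path two coincide (pigeonhole), so it shortens
  reaches-bounded : ∀ {d a} → Reaches d a → ∃[ k ] k ≤ N × iter p k d ≡ a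
  reaches-bounded {d} {a} (k , d↝a) = <-rec Bounded shorten k d↝a
    where
    Bounded : ℕ → Set
    Bounded k = iter p k d ≡ a → ∃[ k′ ] k′ ≤ N × iter p k′ d ≡ a
    shorten : ∀ k → (∀ {k′} → k′ < k → Bounded k′) → Bounded k
    shorten k rec d↝a with k ≤? N
    ... | yes k≤N = k , k≤N , d↝a
    ... | no  k≰N with Finₚ.pigeonhole (n<1+n N) (λ i → iter p (toℕ i) d)
    ...   | i , j , i<j , same = rec shorter (trans (iter-shortcut {toℕ i} same j≤k) d↝a)
      where
      j≤k : toℕ j ≤ k
      j≤k = ≤-trans (m<1+n⇒m≤n (Finₚ.toℕ<n j)) (<⇒≤ (≰⇒> k≰N))
      shorter : toℕ i + (k ∸ toℕ j) < k
      shorter = subst (toℕ i + (k ∸ toℕ j) <_) (m+[n∸m]≡n j≤k) (+-monoˡ-< (k ∸ toℕ j) i<j)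

  iter-N≡root : ∀ {ρ} → RootedAt ρ → ∀ j → iter p N j ≡ ρ
  iter-N≡root {ρ} (ρ-fixed , reach) j with reaches-bounded (reach j)
  ... | k , k≤N , j↝ρ = begin
    iter p N j                   ≡⟨ cong (λ m → iter p m j) (m+[n∸m]≡n k≤N) ⟨
    iter p (k + (N ∸ k)) j       ≡⟨ iter-+ k (N ∸ k) j ⟩
    iter p (N ∸ k) (iter p k j)  ≡⟨ cong (iter p (N ∸ k)) j↝ρ ⟩
    iter p (N ∸ k) ρ             ≡⟨ iter-fixed ρ-fixed (N ∸ k) ⟩
    ρ                            ∎
    where open ≡-Reasoning

  reaches⇒child : ∀ {d a} → Reaches d a → d ≢ a → ∃[ c ] Child a c
  reaches⇒child (k , d↝a) = go k d↝a
    where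
    go : ∀ {d a} k → iter p k d ≡ a → d ≢ a → ∃[ c ] Child a c
    go zero    refl d≢a = ⊥-elim (d≢a refl)
    go {d} {a} (suc k) d↝a d≢a with par p d ≟ a
    ... | yes d→a = d , d→a , d≢a
    ... | no  d↛a = go k d↝a d↛a

module _ {N : ℕ} {p q : ParentMap N} where

  iter-agree : ∀ {d} → (∀ m → par q (iter p m d) ≡ par p (iter p m d)) →
               ∀ m → iter q m d ≡ iter p m d
  iter-agree         agree zero    = refl
  iter-agree {d = d} agree (suc m) =
    trans (cong (iter q m) (agree 0)) (iter-agree {d = par p d} (agree ∘ suc) m)

  reaches-transfer : ∀ {ρ ρ′} → RootedAt p ρ → Reaches q ρ ρ′ →
                     (∀ j → par q j ≡ par p j ⊎ Reaches q j ρ′) → ∀ j → Reaches q j ρ′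
  reaches-transfer {ρ} {ρ′} (_ , reach) ρ↝ρ′ step j = along (proj₁ (reach j)) j (proj₂ (reach j))
    where
    along : ∀ k j → iter p k j ≡ ρ → Reaches q j ρ′
    along zero    j refl = ρ↝ρ′
    along (suc k) j j↝ρ with step j | along k (par p j) j↝ρ
    ... | inj₁ same-par | m , e = suc m , trans (cong (iter q m) same-par) e
    ... | inj₂ j↝ρ′     | _     = j↝ρ′

module _ {N : ℕ} (p : ParentMap N) where

  T-== : ∀ {i j} → T (_==_ p i j) ⇔ i ≡ j
  T-== {i} {j} = mk⇔ (toWitness {a? = i ≟ j}) (fromWitness {a? = i ≟ j})

  T-not-== : ∀ {i j} → T (not (_==_ p i j)) ⇔ i ≢ j
  T-not-== {i} {j} = mk⇔ (toWitnessFalse {a? = i ≟ j}) (fromWitnessFalse {a? = i ≟ j})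

  ∈-upTo : ∀ {k} m → k ≤ m → k ∈ upTo p m
  ∈-upTo zero    z≤n = here refl
  ∈-upTo (suc m) k≤1+m with m≤n⇒m<n∨m≡n k≤1+m
  ... | inj₁ k<1+m = there (∈-upTo m (m<1+n⇒m≤n k<1+m))
  ... | inj₂ refl  = here refl

  isDesc⇔ : ∀ {a d} → T (isDesc p a d) ⇔ Reaches p d a
  isDesc⇔ = mk⇔ to from
    where
    to : ∀ {a d} → T (isDesc p a d) → Reaches p d a
    to t with satisfied (any⁻ _ (upTo p N) t)
    ... | k , d↝a = k , Equivalence.to T-== d↝a
    from : ∀ {a d} → Reaches p d a → T (isDesc p a d)
    from d↝a with reaches-bounded p d↝a
    ... | k , k≤N , d↝a′ = any⁺ _ (lose (∈-upTo N k≤N) (Equivalence.from T-== d↝a′))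

  tree⇒rooted : T (isTree p) → ∃ (RootedAt p)
  tree⇒rooted t with Equivalence.to T-∧ t
  ... | one-root , all-reach-root
    with count≡1⇒∃! (trans (sym (countᵇ≡count (isRoot p) id)) (≡ᵇ⇒≡ _ 1 one-root))
  ...   | ρ , ρ-root , unique =
    ρ , Equivalence.to T-== ρ-root ,
    λ j → N , unique _ (All.lookup (all⁺ _ _ all-reach-root) (∈-allFin j))

  rooted⇒tree : ∀ {ρ} → RootedAt p ρ → T (isTree p)
  rooted⇒tree {ρ} rooted@(ρ-fixed , _) = Equivalence.from T-∧ (one-root , all-reach-root)
    where
    one-root : T (countᵇ p (isRoot p) ≡ᵇ 1)
    one-root = ≡⇒≡ᵇ _ 1 (trans (countᵇ≡count (isRoot p) id)
      (count≡1 ρ (Equivalence.from T-== ρ-fixed)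
                 (λ i i≢ρ i-root → i≢ρ (fixed⇒root p rooted (Equivalence.to T-== i-root)))))
    all-reach-root : T (all (λ i → isRoot p (iter p N i)) (allFin N))
    all-reach-root = all⁻ _ {xs = allFin N} (All.tabulate λ {j} _ →
      Equivalence.from T-== (subst (λ v → par p v ≡ v) (sym (iter-N≡root p rooted j)) ρ-fixed))

  T-isChild : ∀ {i j} → T (isChild p i j) ⇔ Child p i j
  T-isChild = mk⇔ to from
    where
    to : ∀ {i j} → T (isChild p i j) → Child p i j
    to t with Equivalence.to T-∧ t
    ... | not-root , j→i = Equivalence.to T-== j→i ,
                           λ { refl → Equivalence.to T-not-== not-root (Equivalence.to T-== j→i) }
    from : ∀ {i j} → Child p i j → T (isChild p i j)
    from (j→i , j≢i) = Equivalence.from T-∧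
      (Equivalence.from T-not-== (λ j→j → j≢i (trans (sym j→j) j→i)) , Equivalence.from T-== j→i)

  nChildren≡0⇔ : ∀ {i} → nChildren p i ≡ 0 ⇔ (∀ j → ¬ Child p i j)
  nChildren≡0⇔ {i} = mk⇔
    (λ none j → count≡0⇒¬T (trans (sym (countᵇ≡count (isChild p i) id)) none) j
                  ∘ Equivalence.from T-isChild)
    (λ none → trans (countᵇ≡count (isChild p i) id)
                    (count≡0 (λ j → none j ∘ Equivalence.to T-isChild)))

  nChildren≡1⇔ : ∀ {i} → nChildren p i ≡ 1 ⇔ (∃[ c ] Child p i c × (∀ j → Child p i j → j ≡ c))
  nChildren≡1⇔ {i} = mk⇔ to from
    where
    to : nChildren p i ≡ 1 → ∃[ c ] Child p i c × (∀ j → Child p i j → j ≡ c)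
    to one with count≡1⇒∃! (trans (sym (countᵇ≡count (isChild p i) id)) one)
    ... | c , c-child , unique =
      c , Equivalence.to T-isChild c-child , λ j → unique j ∘ Equivalence.from T-isChild
    from : ∃[ c ] Child p i c × (∀ j → Child p i j → j ≡ c) → nChildren p i ≡ 1
    from (c , c-child , unique) = trans (countᵇ≡count (isChild p i) id)
      (count≡1 c (Equivalence.from T-isChild c-child)
                 (λ j j≢c → j≢c ∘ unique j ∘ Equivalence.to T-isChild))

improperInto : ∀ {N} → ParentMap N → Fin N → Bool
improperInto p j = not (isRoot p j) ∧ improperEdge p (par p j) j

properChild : ∀ {N} → ParentMap N → Fin N → Fin N → Bool
properChild p i j = isChild p i j ∧ not (improperEdge p i j)

module _ {N : ℕ} {p q : ParentMap N} {j : Fin N} where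

  improperEdge-cong : (∀ d → Reaches q d j ⇔ Reaches p d j) →
                      ∀ i → improperEdge q i j ≡ improperEdge p i j
  improperEdge-cong same-desc i = cong or (map-cong below-i (allFin N))
    where
    below-i : ∀ d → (isDesc q j d ∧ (toℕ d <ᵇ toℕ i)) ≡ (isDesc p j d ∧ (toℕ d <ᵇ toℕ i))
    below-i d = cong (_∧ (toℕ d <ᵇ toℕ i))
      (T-injective (⇔-trans (isDesc⇔ q) (⇔-trans (same-desc d) (⇔-sym (isDesc⇔ p)))))

  module _ (same-par : par q j ≡ par p j) (same-desc : ∀ d → Reaches q d j ⇔ Reaches p d j) where

    improperInto-cong : improperInto q j ≡ improperInto p j
    improperInto-cong = cong₂ (λ v b → not (_==_ p v j) ∧ b) same-par
      (trans (cong (λ i → improperEdge q i j) same-par) (improperEdge-cong same-desc (par p j)))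

    properChild-cong : ∀ i → properChild q i j ≡ properChild p i j
    properChild-cong i = cong₂ (λ v b → (not (_==_ p v j) ∧ _==_ p v i) ∧ not b) same-par
      (improperEdge-cong same-desc i)

module _ {N : ℕ} {p : ParentMap N} where

  improperInto-root : ∀ {j} → par p j ≡ j → ¬ T (improperInto p j)
  improperInto-root j-root t =
    T-not⇒¬T (proj₁ (Equivalence.to T-∧ t)) (Equivalence.from (T-== p) j-root)

  properChild-nonchild : ∀ {i j} → par p j ≢ i → ¬ T (properChild p i j)
  properChild-nonchild j↛i t =
    j↛i (proj₁ (Equivalence.to (T-isChild p) (proj₁ (Equivalence.to T-∧ t))))

module _ {n : ℕ} {p : ParentMap (suc n)} where

  improperEdge-from-zero : ∀ {j} → ¬ T (improperEdge p zero j)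
  improperEdge-from-zero t with satisfied (any⁻ _ (allFin (suc n)) t)
  ... | d , t′ = proj₂ (Equivalence.to T-∧ t′)

  improperEdge-over-zero : ∀ {i j} → Reaches p zero j → i ≢ zero → T (improperEdge p i j)
  improperEdge-over-zero {zero}      _   i≢0 = ⊥-elim (i≢0 refl)
  improperEdge-over-zero {suc i} {j} 0↝j _   = any⁺ (λ d → isDesc p j d ∧ (toℕ d <ᵇ suc (toℕ i)))
    (lose (∈-allFin zero) (Equivalence.from T-∧ (Equivalence.from (isDesc⇔ p) 0↝j , _)))

  improperInto-under-zero : ∀ {j} → par p j ≡ zero → ¬ T (improperInto p j)
  improperInto-under-zero {j} j→0 t =
    improperEdge-from-zero (subst (λ i → T (improperEdge p i j)) j→0 (proj₂ (Equivalence.to T-∧ t)))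

  improperInto-over-zero : ∀ {j} → Reaches p zero j → par p j ≢ j → par p j ≢ zero →
                           T (improperInto p j)
  improperInto-over-zero 0↝j not-root j↛0 = Equivalence.from T-∧
    (Equivalence.from (T-not-== p) not-root , improperEdge-over-zero 0↝j j↛0)

  properChild-over-zero : ∀ {i j} → Reaches p zero j → i ≢ zero → ¬ T (properChild p i j)
  properChild-over-zero 0↝j i≢0 t =
    T-not⇒¬T (proj₂ (Equivalence.to T-∧ t)) (improperEdge-over-zero 0↝j i≢0)

module _ (N : ℕ) where

  allVecs≡cartesianProduct : ∀ {m} (vs : List (Vec (Fin N) m)) →
    concatMap (λ v → List.map (_∷ v) (allFin N)) vs ≡
    cartesianProductWith (λ v a → a ∷ v) vs (allFin N)
  allVecs≡cartesianProduct []       = refl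
  allVecs≡cartesianProduct (v ∷ vs) =
    cong (List.map (_∷ v) (allFin N) ++_) (allVecs≡cartesianProduct vs)

  ∈-allVecs : ∀ {m} (v : Vec (Fin N) m) → v ∈ allVecs N m
  ∈-allVecs []      = here refl
  ∈-allVecs (a ∷ v) = subst (a ∷ v ∈_) (sym (allVecs≡cartesianProduct (allVecs N _)))
    (∈-cartesianProductWith⁺ (λ v a → a ∷ v) (∈-allVecs v) (∈-allFin a))

  allVecs-unique : ∀ m → Unique (allVecs N m)
  allVecs-unique zero    = All.[] ∷ []
  allVecs-unique (suc m) = subst Unique (sym (allVecs≡cartesianProduct (allVecs N m)))
    (cartesianProductWith⁺ _ (λ e → ∷-injectiveʳ e , ∷-injectiveˡ e) (allVecs-unique m) (allFin⁺ N))

module _ {n k : ℕ} where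

  private
    selected : ParentMap (suc n) → Bool
    selected p = isTree p ∧ (nChildren p zero ≡ᵇ k)

  ∈-trees⇔ : ∀ {p} → p ∈ trees n k ⇔ (∃ (RootedAt p) × nChildren p zero ≡ k)
  ∈-trees⇔ {p} = mk⇔ to from
    where
    to : p ∈ trees n k → ∃ (RootedAt p) × nChildren p zero ≡ k
    to p∈ with Equivalence.to T-∧ (proj₂ (∈-filter⁻ (T? ∘ selected) {xs = allVecs _ _} p∈))
    ... | tree , k-children = tree⇒rooted p tree , ≡ᵇ⇒≡ _ k k-children
    from : ∃ (RootedAt p) × nChildren p zero ≡ k → p ∈ trees n k
    from ((_ , rooted) , k-children) = ∈-filter⁺ (T? ∘ selected) (∈-allVecs (suc n) p)
      (Equivalence.from T-∧ (rooted⇒tree p rooted , ≡⇒≡ᵇ _ k k-children))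

  trees-unique : Unique (trees n k)
  trees-unique = filter⁺ (T? ∘ selected) (allVecs-unique (suc n) (suc n))

raised-parent : ∀ {N} → ParentMap N → Fin N → Fin N
raised-parent p x = if isRoot p (par p x) then x else par p (par p x)

raise : ∀ {N} → ParentMap N → Fin N → ParentMap N
raise p x = (p [ x ]≔ raised-parent p x) [ par p x ]≔ x

module _ {N : ℕ} {p : ParentMap N} {x y : Fin N} where

  par-raise-parent : par p x ≡ y → par (raise p x) y ≡ x
  par-raise-parent refl = lookup∘update (par p x) (p [ x ]≔ raised-parent p x) x

  par-raise-other : par p x ≡ y → ∀ {j} → j ≢ x → j ≢ y → par (raise p x) j ≡ par p j
  par-raise-other refl j≢x j≢y =
    trans (lookup∘update′ j≢y (p [ x ]≔ raised-parent p x) x)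
          (lookup∘update′ j≢x p (raised-parent p x))

  par-raise-self : par p x ≡ y → x ≢ y → par (raise p x) x ≡ (if isRoot p y then x else par p y)
  par-raise-self refl x≢y =
    trans (lookup∘update′ x≢y (p [ x ]≔ raised-parent p x) x)
          (lookup∘update x p (raised-parent p x))

  par-raise-root : par p x ≡ y → x ≢ y → par p y ≡ y → par (raise p x) x ≡ x
  par-raise-root x→y x≢y y-root = trans (par-raise-self x→y x≢y)
    (cong (if_then x else par p y) (Equivalence.to T-≡ (Equivalence.from (T-== p) y-root)))

  par-raise-nonroot : par p x ≡ y → x ≢ y → par p y ≢ y → par (raise p x) x ≡ par p y
  par-raise-nonroot x→y x≢y y-nonroot = trans (par-raise-self x→y x≢y)
    (cong (if_then x else par p y) (¬T⇒≡false (y-nonroot ∘ Equivalence.to (T-== p))))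

lookup-ext : ∀ {A : Set} {N} {u v : Vec A N} → (∀ i → lookup u i ≡ lookup v i) → u ≡ v
lookup-ext {u = u} {v} same =
  trans (sym (tabulate∘lookup u)) (trans (tabulate-cong same) (tabulate∘lookup v))

module _ {N : ℕ} {p : ParentMap N} {x y : Fin N} (x→y : par p x ≡ y) (x≢y : x ≢ y) where

  private
    p′ = raise p x
    y→x′ : par p′ y ≡ x
    y→x′ = par-raise-parent {p = p} {x = x} x→y
    other : ∀ {j} → j ≢ x → j ≢ y → par p′ j ≡ par p j
    other = par-raise-other {p = p} {x = x} x→y
    x-root′ : par p y ≡ y → par p′ x ≡ x
    x-root′ = par-raise-root {p = p} {x = x} x→y x≢y
    x→py′ : par p y ≢ y → par p′ x ≡ par p y
    x→py′ = par-raise-nonroot {p = p} {x = x} x→y x≢y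

  raise-involutive : par p y ≢ x → raise p′ y ≡ p
  raise-involutive y↛x = lookup-ext same
    where
    same : ∀ j → par (raise p′ y) j ≡ par p j
    same j with j ≟ x | j ≟ y
    ... | yes refl | _      = trans (par-raise-parent {p = p′} {x = y} y→x′) (sym x→y)
    ... | no j≢x   | no j≢y =
      trans (par-raise-other {p = p′} {x = y} y→x′ j≢y j≢x) (other j≢x j≢y)
    ... | no _     | yes refl with par p y ≟ y
    ...   | yes y-root    =
      trans (par-raise-root {p = p′} {x = y} y→x′ (x≢y ∘ sym) (x-root′ y-root)) (sym y-root)
    ...   | no  y-nonroot =
      trans (par-raise-nonroot {p = p′} {x = y} y→x′ (x≢y ∘ sym) x↛x′) (x→py′ y-nonroot)
      where
      x↛x′ : par p′ x ≢ x
      x↛x′ = y↛x ∘ trans (sym (x→py′ y-nonroot))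

  raise-reaches : ∀ {d j} → j ≢ x → j ≢ y → Reaches p d j → Reaches p′ d j
  raise-reaches {j = j} j≢x j≢y (k , d↝j) = go k _ d↝j
    where
    go : ∀ k d → iter p k d ≡ j → Reaches p′ d j
    go zero    d refl = 0 , refl
    go (suc k) d d↝j with go k (par p d) d↝j | d ≟ x | d ≟ y
    ... | zero  , e | yes refl | _      = ⊥-elim (j≢y (trans (sym e) x→y))
    ... | suc m , e | yes refl | _      =
      m , trans (cong (iter p′ m) (sym (trans (cong (par p′) x→y) y→x′))) e
    ... | m     , e | no d≢x   | no d≢y = suc m , trans (cong (iter p′ m) (other d≢x d≢y)) e
    ... | m     , e | no _     | yes refl with par p y ≟ y
    ...   | yes y-root    =
      ⊥-elim (j≢y (trans (sym d↝j) (trans (cong (iter p k) y-root) (iter-fixed p y-root k))))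
    ...   | no  y-nonroot =
      suc (suc m) , trans (cong (iter p′ (suc m)) y→x′) (trans (cong (iter p′ m) (x→py′ y-nonroot)) e)

  raise-rooted : ∀ {ρ} → RootedAt p ρ → ∃ (RootedAt p′)
  raise-rooted {ρ} rooted@(ρ-fixed , reach) with par p y ≟ y
  ... | yes y-root = x , x-root′ y-root , reaches-transfer rooted ρ↝x step
    where
    ρ↝x : Reaches p′ ρ x
    ρ↝x = 1 , subst (λ v → par p′ v ≡ x) (fixed⇒root p rooted y-root) y→x′
    step : ∀ j → par p′ j ≡ par p j ⊎ Reaches p′ j x
    step j with j ≟ x | j ≟ y
    ... | yes refl | _        = inj₂ (0 , refl)
    ... | no _     | yes refl = inj₂ (1 , y→x′)
    ... | no j≢x   | no j≢y   = inj₁ (other j≢x j≢y)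
  ... | no y-nonroot = ρ , trans (other ρ≢x ρ≢y) ρ-fixed , reaches-transfer rooted (0 , refl) step
    where
    ρ≢y : ρ ≢ y
    ρ≢y refl = y-nonroot ρ-fixed
    ρ≢x : ρ ≢ x
    ρ≢x refl = x≢y (trans (sym ρ-fixed) x→y)
    -- a path from the grandparent of x back to x or y would close a cycle through y
    avoids-x : ∀ m → iter p m (par p y) ≢ x
    avoids-x m e = ρ≢y (sym (cycle⇒root p rooted (suc m) y
      (trans (iter-suc p (suc m) y) (trans (cong (par p) e) x→y))))
    avoids-y : ∀ m → iter p m (par p y) ≢ y
    avoids-y m e = ρ≢y (sym (cycle⇒root p rooted m y e))
    x↝ρ : Reaches p′ x ρ
    x↝ρ with reach (par p y)
    ... | m , e = suc m , trans (cong (iter p′ m) (x→py′ y-nonroot))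
      (trans (iter-agree (λ k → other (avoids-x k) (avoids-y k)) m) e)
    step : ∀ j → par p′ j ≡ par p j ⊎ Reaches p′ j ρ
    step j with j ≟ x | j ≟ y
    ... | yes refl | _        = inj₂ x↝ρ
    ... | no _     | yes refl =
      inj₂ (suc (proj₁ x↝ρ) , trans (cong (iter p′ (proj₁ x↝ρ)) y→x′) (proj₂ x↝ρ))
    ... | no j≢x   | no j≢y   = inj₁ (other j≢x j≢y)

module _ {N : ℕ} {p : ParentMap N} {x y : Fin N}
         (x→y : par p x ≡ y) (x≢y : x ≢ y) (y↛x : par p y ≢ x) where

  raise-reaches⇔ : ∀ {d j} → j ≢ x → j ≢ y → Reaches (raise p x) d j ⇔ Reaches p d j
  raise-reaches⇔ {d} {j} j≢x j≢y = mk⇔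
    (subst (λ q → Reaches q d j) (raise-involutive x→y x≢y y↛x)
      ∘ raise-reaches {p = raise p x} {x = y} (par-raise-parent {p = p} {x = x} x→y) (x≢y ∘ sym)
                      j≢y j≢x)
    (raise-reaches x→y x≢y j≢x j≢y)

unique-map⁺ : ∀ {A B : Set} {f : A → B} {xs : List A} →
              (∀ {a b} → a ∈ xs → b ∈ xs → f a ≡ f b → a ≡ b) → Unique xs → Unique (List.map f xs)
unique-map⁺ inj []           = []
unique-map⁺ inj (x∉xs ∷ uxs) =
  Allₚ.map⁺ (All.tabulate λ b∈xs fx≡fb →
    All.lookup x∉xs b∈xs (inj (here refl) (there b∈xs) fx≡fb))
  ∷ unique-map⁺ (λ a∈ b∈ → inj (there a∈) (there b∈)) uxs

module _ {c ℓ : Level} (R : CommutativeSemiring c ℓ) where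

  open CommutativeSemiring R
    using ( Carrier; _≈_; _+_; _*_; 0#; 1#; setoid; isEquivalence; rawSemiring; +-isCommutativeMonoid
          ; +-cong; +-congˡ; *-assoc; zeroʳ; distribˡ)
    renaming (refl to ≈-refl)
  open import Algebra.Definitions.RawSemiring rawSemiring using (_^_)
  open import Relation.Binary.Reasoning.Setoid setoid

  ∑ : {A : Set} → (A → Carrier) → List A → Carrier
  ∑ F = List.foldr (λ a s → F a + s) 0#

  ∑-↭ : ∀ {A : Set} (F : A → Carrier) {xs ys : List A} → xs ↭ ys → ∑ F xs ≈ ∑ F ys
  ∑-↭ F {xs} {ys} xs↭ys = begin
    ∑ F xs                            ≡⟨ foldr-map _+_ F 0# xs ⟨
    List.foldr _+_ 0# (List.map F xs) ≈⟨ foldr-commMonoid setoid +-isCommutativeMonoid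
                                           (↭⇒↭ₛ′ isEquivalence (↭ₚ.map⁺ F xs↭ys)) ⟩
    List.foldr _+_ 0# (List.map F ys) ≡⟨ foldr-map _+_ F 0# ys ⟩
    ∑ F ys                            ∎

  ∑-cong-∈ : ∀ {A : Set} {F G : A → Carrier} {xs} → (∀ {a} → a ∈ xs → F a ≈ G a) → ∑ F xs ≈ ∑ G xs
  ∑-cong-∈ {xs = []}     F≈G = ≈-refl
  ∑-cong-∈ {xs = a ∷ xs} F≈G = +-cong (F≈G (here refl)) (∑-cong-∈ (F≈G ∘ there))

  ∑-*ˡ : ∀ {A : Set} x (F : A → Carrier) xs → ∑ (λ a → x * F a) xs ≈ x * ∑ F xs
  ∑-*ˡ x F []       = begin
    0#     ≈⟨ zeroʳ x ⟨
    x * 0# ∎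
  ∑-*ˡ x F (a ∷ xs) = begin
    x * F a + ∑ (λ a → x * F a) xs  ≈⟨ +-congˡ (∑-*ˡ x F xs) ⟩
    x * F a + x * ∑ F xs            ≈⟨ distribˡ x (F a) (∑ F xs) ⟨
    x * (F a + ∑ F xs)              ∎

  ∑-bijection : ∀ {A B : Set} {xs : List A} {ys : List B} (F : B → Carrier) (f : A → B) (g : B → A) →
                Unique xs → Unique ys →
                (∀ {a} → a ∈ xs → f a ∈ ys) → (∀ {b} → b ∈ ys → g b ∈ xs) →
                (∀ {a} → a ∈ xs → g (f a) ≡ a) → (∀ {b} → b ∈ ys → f (g b) ≡ b) →
                ∑ (F ∘ f) xs ≈ ∑ F ys
  ∑-bijection {xs = xs} {ys} F f g uxs uys f∈ g∈ gf fg = begin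
    ∑ (F ∘ f) xs         ≡⟨ foldr-map (λ b s → F b + s) f 0# xs ⟨
    ∑ F (List.map f xs)  ≈⟨ ∑-↭ F (∼bag⇒↭ (unique∧set⇒bag (unique-map⁺ f-injective uxs) uys
                                                            (mk⇔ to from))) ⟩
    ∑ F ys               ∎
    where
    f-injective : ∀ {a a′} → a ∈ xs → a′ ∈ xs → f a ≡ f a′ → a ≡ a′
    f-injective a∈ a′∈ fa≡fa′ = trans (sym (gf a∈)) (trans (cong g fa≡fa′) (gf a′∈))
    to : ∀ {b} → b ∈ List.map f xs → b ∈ ys
    to b∈ with ∈-map⁻ f b∈
    ... | a , a∈ , refl = f∈ a∈
    from : ∀ {b} → b ∈ ys → b ∈ List.map f xs
    from b∈ = subst (_∈ List.map f xs) (fg b∈) (∈-map⁺ f (g∈ b∈))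

  weight-suc-imprope : ∀ {n} {p q : ParentMap (suc n)} y φ → imprope q ≡ suc (imprope p) →
                       (∀ i → pdeg q (suc i) ≡ pdeg p (suc i)) → weight R y φ q ≈ y * weight R y φ p
  weight-suc-imprope {n} {p} {q} y φ one-more same-pdeg = begin
    (y ^ imprope q) * ∏ q        ≡⟨ cong₂ (λ k Π → (y ^ k) * Π) one-more
                                      (foldr-cong (λ i Π → cong (λ d → φhat R φ d * Π) (same-pdeg i))
                                                  refl (allFin n)) ⟩
    (y * y ^ imprope p) * ∏ p    ≈⟨ *-assoc y _ _ ⟩
    y * ((y ^ imprope p) * ∏ p)  ∎
    where
    ∏ : ParentMap (suc n) → Carrier
    ∏ r = List.foldr (λ i Π → φhat R φ (pdeg r (suc i)) * Π) 1# (allFin n)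

onlyChild : ParentMap (suc n) → Fin (suc n)
onlyChild p with Finₚ.any? (λ j → T? (isChild p zero j))
... | yes (c , _) = c
... | no  _       = zero

onlyChild-unique : ∀ {p : ParentMap (suc n)} {c} → Child p zero c → (∀ j → Child p zero j → j ≡ c) →
                   onlyChild p ≡ c
onlyChild-unique {p = p} c-child unique with Finₚ.any? (λ j → T? (isChild p zero j))
... | yes (c′ , c′-child) = unique c′ (Equivalence.to (T-isChild p) c′-child)
... | no  childless       = ⊥-elim (childless (_ , Equivalence.from (T-isChild p) c-child))

demote : ParentMap (suc n) → ParentMap (suc n)
demote p = raise p (onlyChild p)

promote : ParentMap (suc n) → ParentMap (suc n)
promote p = raise p zero

module Demotion {n : ℕ} {p : ParentMap (suc n)} {ρ c} (rooted : RootedAt p ρ)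
                (c-child : Child p zero c) (only : ∀ j → Child p zero j → j ≡ c) where

  private
    p′ = raise p c
    c→0 : par p c ≡ zero
    c→0 = proj₁ c-child
    c≢0 : c ≢ zero
    c≢0 = proj₂ c-child
    0↛c : par p zero ≢ c
    0↛c 0→c = c≢0 (trans (sym c-fixed) c→0)
      where
      c-fixed : par p c ≡ c
      c-fixed = subst (λ v → par p v ≡ v)
                      (sym (cycle⇒root p rooted 1 c (trans (cong (par p) c→0) 0→c))) (proj₁ rooted)
    0→c′ : par p′ zero ≡ c
    0→c′ = par-raise-parent {p = p} {x = c} c→0
    0↝c′ : Reaches p′ zero c
    0↝c′ = 1 , 0→c′
    other : ∀ {j} → j ≢ c → j ≢ zero → par p′ j ≡ par p j
    other = par-raise-other {p = p} {x = c} c→0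
    c-root′ : par p zero ≡ zero → par p′ c ≡ c
    c-root′ = par-raise-root {p = p} {x = c} c→0 c≢0
    c→p0′ : par p zero ≢ zero → par p′ c ≡ par p zero
    c→p0′ = par-raise-nonroot {p = p} {x = c} c→0 c≢0
    same-desc : ∀ {j} → j ≢ c → j ≢ zero → ∀ d → Reaches p′ d j ⇔ Reaches p d j
    same-desc j≢c j≢0 d = raise-reaches⇔ c→0 c≢0 0↛c j≢c j≢0

  demote≡raise : demote p ≡ p′
  demote≡raise = cong (raise p) (onlyChild-unique {p = p} c-child only)

  promote-demote : raise p′ zero ≡ p
  promote-demote = raise-involutive c→0 c≢0 0↛c

  demoted-∈ : p′ ∈ trees n 0
  demoted-∈ = Equivalence.from ∈-trees⇔
    (raise-rooted c→0 c≢0 rooted , Equivalence.from (nChildren≡0⇔ p′) childless)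
    where
    childless : ∀ j → ¬ Child p′ zero j
    childless j (j→0 , j≢0) with j ≟ c | par p zero ≟ zero
    ... | no j≢c   | _            = j≢c (only j (trans (sym (other j≢c j≢0)) j→0 , j≢0))
    ... | yes refl | yes 0-root   = c≢0 (trans (sym (c-root′ 0-root)) j→0)
    ... | yes refl | no 0-nonroot = 0-nonroot (trans (sym (c→p0′ 0-nonroot)) j→0)

  -- Indexing edges by their lower end, the improper edges change at a single vertex:
  -- at 1 if 1 was the root, at c otherwise.
  imprope-demote : imprope p′ ≡ suc (imprope p)
  imprope-demote = begin
    imprope p′                    ≡⟨ countᵇ≡count (improperInto p′) id ⟩
    count (improperInto p′)       ≡⟨ one-more (par p zero ≟ zero) ⟩
    suc (count (improperInto p))  ≡⟨ cong suc (countᵇ≡count (improperInto p) id) ⟨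
    suc (imprope p)               ∎
    where
    open ≡-Reasoning
    kept : ∀ {j} → j ≢ c → j ≢ zero → improperInto p j ≡ improperInto p′ j
    kept j≢c j≢0 = sym (improperInto-cong (other j≢c j≢0) (same-desc j≢c j≢0))
    into-c : ¬ T (improperInto p c)
    into-c = improperInto-under-zero c→0
    into-0′ : T (improperInto p′ zero)
    into-0′ = improperInto-over-zero (0 , refl) (c≢0 ∘ trans (sym 0→c′)) (c≢0 ∘ trans (sym 0→c′))
    one-more : Dec (par p zero ≡ zero) → count (improperInto p′) ≡ suc (count (improperInto p))
    one-more (yes 0-root) = count-update zero kept-off-0 (improperInto-root 0-root) into-0′
      where
      kept-off-0 : ∀ j → j ≢ zero → improperInto p j ≡ improperInto p′ j
      kept-off-0 j j≢0 with j ≟ c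
      ... | yes refl = both-false into-c (improperInto-root (c-root′ 0-root))
      ... | no  j≢c  = kept j≢c j≢0
    one-more (no 0-nonroot) = count-update c kept-off-c into-c into-c′
      where
      into-c′ : T (improperInto p′ c)
      into-c′ = improperInto-over-zero 0↝c′ (0↛c ∘ trans (sym (c→p0′ 0-nonroot)))
                                             (0-nonroot ∘ trans (sym (c→p0′ 0-nonroot)))
      kept-off-c : ∀ j → j ≢ c → improperInto p j ≡ improperInto p′ j
      kept-off-c j j≢c with j ≟ zero
      ... | yes refl = both-true (improperInto-over-zero (0 , refl) 0-nonroot 0-nonroot) into-0′
      ... | no  j≢0  = kept j≢c j≢0

  pdeg-demote : ∀ i → pdeg p′ (suc i) ≡ pdeg p (suc i)
  pdeg-demote i = begin
    pdeg p′ (suc i)                 ≡⟨ countᵇ≡count (properChild p′ (suc i)) id ⟩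
    count (properChild p′ (suc i))  ≡⟨ count-cong kept ⟩
    count (properChild p (suc i))   ≡⟨ countᵇ≡count (properChild p (suc i)) id ⟨
    pdeg p (suc i)                  ∎
    where
    open ≡-Reasoning
    1+i≢0 : suc i ≢ zero
    1+i≢0 ()
    kept : ∀ j → properChild p′ (suc i) j ≡ properChild p (suc i) j
    kept j with j ≟ zero | j ≟ c
    ... | yes refl | _        = both-false (properChild-over-zero {p = p′} (0 , refl) 1+i≢0)
                                           (properChild-over-zero {p = p} (0 , refl) 1+i≢0)
    ... | no _     | yes refl = both-false (properChild-over-zero {p = p′} 0↝c′ 1+i≢0)
                                           (properChild-nonchild (Finₚ.0≢1+n ∘ trans (sym c→0)))
    ... | no j≢0   | no j≢c   = properChild-cong (other j≢c j≢0) (same-desc j≢c j≢0) (suc i)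

module _ {n : ℕ} {p : ParentMap (suc n)} (p∈ : p ∈ trees n 1) where

  private
    member = Equivalence.to ∈-trees⇔ p∈
    child = Equivalence.to (nChildren≡1⇔ p) (proj₂ member)
    open Demotion (proj₂ (proj₁ member)) (proj₁ (proj₂ child)) (proj₂ (proj₂ child))

  demote-∈ : demote p ∈ trees n 0
  demote-∈ = subst (_∈ trees n 0) (sym demote≡raise) demoted-∈

  promote∘demote : promote (demote p) ≡ p
  promote∘demote = trans (cong promote demote≡raise) promote-demote

  weight-demote : ∀ {c ℓ} (R : CommutativeSemiring c ℓ) y φ →
                  let open CommutativeSemiring R in weight R y φ (demote p) ≈ y * weight R y φ p
  weight-demote R y φ = subst (λ q → CommutativeSemiring._≈_ R (weight R y φ q) _) (sym demote≡raise)
    (weight-suc-imprope R {p = p} {q = raise p (proj₁ child)} y φ imprope-demote pdeg-demote)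

-- `suc v` is a vertex other than 1, which forces the childless vertex 1 not to be the root
module Promotion {n : ℕ} {p : ParentMap (suc n)} (p∈ : p ∈ trees n 0) (v : Fin n) where

  private
    member = Equivalence.to ∈-trees⇔ p∈
    rooted = proj₂ (proj₁ member)
    childless = Equivalence.to (nChildren≡0⇔ p) (proj₂ member)
    y = par p zero
    0≢y : zero ≢ y
    0≢y 0≡y = childless _ (proj₂ (reaches⇒child p 1+v↝0 (λ ())))
      where
      1+v↝0 : Reaches p (suc v) zero
      1+v↝0 = subst (Reaches p (suc v)) (sym (fixed⇒root p rooted (sym 0≡y)))
                    (proj₂ rooted (suc v))
    y↛0 : par p y ≢ zero
    y↛0 y→0 = childless y (y→0 , 0≢y ∘ sym)
    only-child : Child (promote p) zero y × (∀ j → Child (promote p) zero j → j ≡ y)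
    only-child = (par-raise-parent {p = p} {x = zero} refl , 0≢y ∘ sym) , only
      where
      only : ∀ j → Child (promote p) zero j → j ≡ y
      only j (j→0 , j≢0) with j ≟ y
      ... | yes j≡y = j≡y
      ... | no  j≢y = ⊥-elim (childless j (trans (sym other′) j→0 , j≢0))
        where other′ = par-raise-other {p = p} {x = zero} refl j≢0 j≢y

  promote-∈ : promote p ∈ trees n 1
  promote-∈ = Equivalence.from ∈-trees⇔
    (raise-rooted refl 0≢y rooted , Equivalence.from (nChildren≡1⇔ (promote p)) (_ , only-child))

  demote∘promote : demote (promote p) ≡ p
  demote∘promote =
    trans (cong (raise (promote p)) (onlyChild-unique {p = promote p} (proj₁ only-child)
                                                                      (proj₂ only-child)))
          (raise-involutive refl 0≢y y↛0)

open Promotion public using (promote-∈; demote∘promote)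

proposition1p6 : {c ℓ : Level} (R : CommutativeSemiring c ℓ) (n : ℕ) → 1 ≤ n →
    (y : CommutativeSemiring.Carrier R) (φ : ℕ → CommutativeSemiring.Carrier R) →
    CommutativeSemiring._≈_ R (t R n 0 y φ) (CommutativeSemiring._*_ R y (t R n 1 y φ))
proposition1p6 R (suc m) _ y φ = begin
  ∑ R w (trees (suc m) 0)
    ≈⟨ ∑-bijection R w demote promote trees-unique trees-unique
         demote-∈ (λ p∈ → promote-∈ p∈ zero) promote∘demote (λ p∈ → demote∘promote p∈ zero) ⟨
  ∑ R (w ∘ demote) (trees (suc m) 1)
    ≈⟨ ∑-cong-∈ R {xs = trees (suc m) 1} (λ p∈ → weight-demote p∈ R y φ) ⟩
  ∑ R (λ p → y * w p) (trees (suc m) 1)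
    ≈⟨ ∑-*ˡ R y w (trees (suc m) 1) ⟩
  y * ∑ R w (trees (suc m) 1)
    ∎
  where
  open CommutativeSemiring R using (_*_; setoid)
  open import Relation.Binary.Reasoning.Setoid setoid
  w = weight R y φ
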